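{- Let $n$ be a Zumkeller number with prime factorization $n=p_1^{k_1}p_2^{k_2}\cdots p_m^{k_m}$. Then for any positive integers $l_1,\ldots,l_m$, the number $$p_1^{k_1+l_1(k_1+1)}p_2^{k_2+l_2(k_2+1)}\cdots p_m^{k_m+l_m(k_m+1)}$$ is a Zumkeller number.
   Context: A positive integer $n$ is a Zumkeller number if the set of all positive divisors of $n$ can be partitioned into two disjoint parts whose sums are equal. -}

module Defs where

open import Data.Nat using (ℕ; zero; suc; _+_; _*_; _^_)
open import Data.Nat.Divisibility using (_∣_; _∣?_)
open import Data.Fin using (Fin; zero; suc)
open import Data.Bool using (Bool; true; false; T; not)
open import Data.List using (List; filter; upTo; map)
open import Data.Nat.ListAction using (sum)
open import Data.Product using (∃)
open import Relation.Binary.PropositionalEquality using (_≡_)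

divisors : ℕ → List ℕ
divisors n = filter (λ d → d ∣? n) (map suc (upTo n))

sumWhere : (ℕ → Bool) → Bool → List ℕ → ℕ
sumWhere c b xs = sum (filter (λ d → Data.Bool._≟_ (c d) b) xs)

-- n is Zumkeller: n positive and its (distinct) divisors can be split
-- into two disjoint parts (labelled true / false) with equal sums
Zumkeller : ℕ → Set
Zumkeller zero = Data.Bool.T false
Zumkeller (suc k) =
  ∃ λ (c : ℕ → Bool) →
    sumWhere c true (divisors (suc k)) ≡ sumWhere c false (divisors (suc k))

∏ : (m : ℕ) → (Fin m → ℕ) → ℕ
∏ zero f = 1
∏ (suc m) f = f zero * ∏ m (λ i → f (suc i))

module Submission where

-- Let p be prime with p^k ∥ n and put q = p^(k+1).  For every
-- N = q^j * n, a divisor of q * N is either a divisor of n (if q does not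
-- divide it) or q times a divisor of N, and these two cases are disjoint:
--     divisors (q * N)  ↭  divisors n ++ map (q *_) (divisors N).
-- Gluing a balanced colouring of n with (a rescaling of) a balanced colouring
-- of N therefore gives a balanced colouring of q * N; by induction on j,
-- q^j * n is Zumkeller, i.e. the exponent k of p may be raised to k + j(k+1).
--
-- All primes.  Induction on the number of primes, carrying the cofactor R
-- (coprime to the remaining primes) that accumulates the raised powers.

open import Defs
open import Data.Nat using (ℕ; zero; suc; _+_; _*_; _^_; _≥_; NonZero)
open import Data.Nat.Properties
open import Data.Nat.Divisibility
open import Data.Nat.DivMod using (_/_; m*n/n≡m)
open import Data.Nat.Primality using (Prime; prime⇒nonZero; prime⇒irreducible; prime⇒nonTrivial; euclidsLemma)
open import Data.Nat.Coprimality using (Coprime; coprime-divisor)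
open import Data.Nat.ListAction using (sum)
open import Data.Nat.ListAction.Properties using (sum-++; sum-↭)
open import Data.Nat.Solver using (module +-*-Solver)
open import Algebra.Properties.CommutativeSemigroup *-commutativeSemigroup using (x∙yz≈y∙xz; xy∙z≈y∙xz)
open import Data.Bool using (Bool; true; false; if_then_else_)
import Data.Bool as Bool
open import Data.List using (List; []; _∷_; filter; upTo; map; _++_)
open import Data.List.Properties using (filter-++)
open import Data.List.Membership.Propositional using (_∈_)
open import Data.List.Membership.Propositional.Properties
  using (∈-filter⁺; ∈-filter⁻; ∈-map⁺; ∈-map⁻; ∈-upTo⁺; ∈-++⁺ˡ; ∈-++⁺ʳ; ∈-++⁻)
open import Data.List.Membership.Propositional.Properties.WithK using (unique∧set⇒bag)
open import Data.List.Relation.Unary.Any using (here; there)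
open import Data.List.Relation.Unary.Unique.Propositional using (Unique)
import Data.List.Relation.Unary.Unique.Propositional.Properties as Unique
open import Data.List.Relation.Binary.Permutation.Propositional using (_↭_; ↭-sym)
open import Data.List.Relation.Binary.Permutation.Propositional.Properties using (filter-↭)
open import Data.List.Relation.Binary.BagAndSetEquality using (∼bag⇒↭)
open import Function.Bundles using (mk⇔)
open import Data.Product using (∃; _×_; _,_)
open import Data.Sum using (inj₁; inj₂; [_,_])
open import Data.Empty using (⊥-elim)
open import Relation.Nullary using (¬_; yes; no; does)
open import Relation.Nullary.Decidable using (dec-true; dec-false)
open import Relation.Binary.PropositionalEquality using (_≡_; refl; sym; trans; cong; cong₂; subst; module ≡-Reasoning)
open import Data.Fin using (Fin)
import Data.Fin as Fin
import Data.Fin.Properties as Fin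
open import Function.Definitions using (Injective)
open import Function.Base using (_$_)

-- c splits xs into two parts of equal sum (a record, so that c and xs are
-- recoverable from the type by unification)
record Balanced (c : ℕ → Bool) (xs : List ℕ) : Set where
  constructor balanced
  field sums-equal : sumWhere c true xs ≡ sumWhere c false xs

sumWhere-++ : ∀ c b xs ys → sumWhere c b (xs ++ ys) ≡ sumWhere c b xs + sumWhere c b ys
sumWhere-++ c b xs ys =
  trans (cong sum (filter-++ (λ d → c d Bool.≟ b) xs ys)) (sum-++ (filter (λ d → c d Bool.≟ b) xs) _)

sumWhere-cong : ∀ {c c'} b xs → (∀ {x} → x ∈ xs → c x ≡ c' x) → sumWhere c b xs ≡ sumWhere c' b xs
sumWhere-cong b [] agree = refl
sumWhere-cong {c} {c'} b (x ∷ xs) agree with c x Bool.≟ b | c' x Bool.≟ b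
... | yes _  | yes _  = cong (x +_) (sumWhere-cong b xs (λ x∈ → agree (there x∈)))
... | no _   | no _   = sumWhere-cong b xs (λ x∈ → agree (there x∈))
... | yes cx | no c'x = ⊥-elim (c'x (trans (sym (agree (here refl))) cx))
... | no cx  | yes c'x = ⊥-elim (cx (trans (agree (here refl)) c'x))

sumWhere-map : ∀ q c b xs → sumWhere c b (map (q *_) xs) ≡ q * sumWhere (λ y → c (q * y)) b xs
sumWhere-map q c b [] = sym (*-zeroʳ q)
sumWhere-map q c b (x ∷ xs) with c (q * x) Bool.≟ b
... | yes _ = trans (cong (q * x +_) (sumWhere-map q c b xs)) (sym (*-distribˡ-+ q x _))
... | no _  = sumWhere-map q c b xs

balanced-++ : ∀ {c xs ys} → Balanced c xs → Balanced c ys → Balanced c (xs ++ ys)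
balanced-++ {c} {xs} {ys} (balanced bal-xs) (balanced bal-ys) = balanced $ begin
  sumWhere c true (xs ++ ys)                       ≡⟨ sumWhere-++ c true xs ys ⟩
  sumWhere c true xs + sumWhere c true ys          ≡⟨ cong₂ _+_ bal-xs bal-ys ⟩
  sumWhere c false xs + sumWhere c false ys        ≡⟨ sumWhere-++ c false xs ys ⟨
  sumWhere c false (xs ++ ys)                      ∎
  where open ≡-Reasoning

balanced-↭ : ∀ {c xs ys} → xs ↭ ys → Balanced c xs → Balanced c ys
balanced-↭ xs↭ys (balanced bal) = balanced $
  trans (sym (sum-↭ (filter-↭ _ xs↭ys))) (trans bal (sum-↭ (filter-↭ _ xs↭ys)))

balanced-cong : ∀ {c c' xs} → (∀ {x} → x ∈ xs → c x ≡ c' x) → Balanced c xs → Balanced c' xs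
balanced-cong {xs = xs} agree (balanced bal) = balanced $
  trans (sym (sumWhere-cong true xs agree)) (trans bal (sumWhere-cong false xs agree))

balanced-map : ∀ q {c xs} → Balanced (λ y → c (q * y)) xs → Balanced c (map (q *_) xs)
balanced-map q {c} {xs} (balanced bal) = balanced $
  trans (sumWhere-map q c true xs) (trans (cong (q *_) bal) (sym (sumWhere-map q c false xs)))

divisors-unique : ∀ N → Unique (divisors N)
divisors-unique N = Unique.filter⁺ _ (Unique.map⁺ suc-injective (Unique.upTo⁺ N))

∈-divisors⁺ : ∀ {N x} .{{_ : NonZero N}} → x ∣ N → x ∈ divisors N
∈-divisors⁺ {suc N} {zero} (divides q eq) with () ← trans eq (*-zeroʳ q)
∈-divisors⁺ {suc N} {suc x} x∣N = ∈-filter⁺ (_∣? suc N) (∈-map⁺ suc (∈-upTo⁺ (∣⇒≤ x∣N))) x∣N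

∈-divisors⁻ : ∀ {N x} → x ∈ divisors N → x ∣ N
∈-divisors⁻ {N} x∈ with ∈-filter⁻ (_∣? N) {xs = map suc (upTo N)} x∈
... | _ , x∣N = x∣N

↭-of-same-elements : ∀ {xs ys : List ℕ} → Unique xs → Unique ys
  → (∀ {x} → x ∈ xs → x ∈ ys) → (∀ {x} → x ∈ ys → x ∈ xs) → xs ↭ ys
↭-of-same-elements uxs uys to from = ∼bag⇒↭ (unique∧set⇒bag uxs uys (mk⇔ to from))

Zumkeller⇒nonZero : ∀ {N} → Zumkeller N → NonZero N
Zumkeller⇒nonZero {suc N} _ = _

Zumkeller⇒balanced : ∀ {N} → Zumkeller N → ∃ λ c → Balanced c (divisors N)
Zumkeller⇒balanced {suc N} (c , sums-equal) = c , balanced sums-equal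

balanced⇒Zumkeller : ∀ {N c} .{{_ : NonZero N}} → Balanced c (divisors N) → Zumkeller N
balanced⇒Zumkeller {suc N} {c} (balanced sums-equal) = c , sums-equal

divisors-split : ∀ q n N .{{_ : NonZero q}} .{{_ : NonZero n}} .{{_ : NonZero N}}
  → n ∣ N → ¬ q ∣ n → (∀ {x} → x ∣ q * N → ¬ q ∣ x → x ∣ n)
  → divisors (q * N) ↭ divisors n ++ map (q *_) (divisors N)
divisors-split q n N n∣N q∤n coprime-part =
  ↭-of-same-elements (divisors-unique (q * N)) unique-rhs to from
  where
  instance
    qN≢0 : NonZero (q * N)
    qN≢0 = m*n≢0 q N

  disjoint : ∀ {x} → ¬ (x ∈ divisors n × x ∈ map (q *_) (divisors N))
  disjoint (x∈n , x∈qN) with ∈-map⁻ (q *_) x∈qN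
  ... | y , _ , refl = q∤n (∣-trans (m∣m*n y) (∈-divisors⁻ x∈n))

  unique-rhs : Unique (divisors n ++ map (q *_) (divisors N))
  unique-rhs = Unique.++⁺ (divisors-unique n)
    (Unique.map⁺ (λ {a} {b} → *-cancelˡ-≡ a b q) (divisors-unique N)) disjoint

  to : ∀ {x} → x ∈ divisors (q * N) → x ∈ divisors n ++ map (q *_) (divisors N)
  to {x} x∈ with q ∣? x
  ... | no q∤x = ∈-++⁺ˡ (∈-divisors⁺ (coprime-part (∈-divisors⁻ x∈) q∤x))
  ... | yes (divides y refl) = ∈-++⁺ʳ (divisors n)
    (subst (_∈ map (q *_) (divisors N)) (*-comm q y)
      (∈-map⁺ (q *_) (∈-divisors⁺ (*-cancelˡ-∣ q (subst (_∣ q * N) (*-comm y q) (∈-divisors⁻ x∈))))))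

  from : ∀ {x} → x ∈ divisors n ++ map (q *_) (divisors N) → x ∈ divisors (q * N)
  from x∈ with ∈-++⁻ (divisors n) x∈
  ... | inj₁ x∈n = ∈-divisors⁺ (∣-trans (∈-divisors⁻ x∈n) (∣n⇒∣m*n q n∣N))
  ... | inj₂ x∈qN with ∈-map⁻ (q *_) x∈qN
  ...   | y , y∈N , refl = ∈-divisors⁺ (*-monoʳ-∣ q (∈-divisors⁻ y∈N))

glue : ∀ q .{{_ : NonZero q}} → (ℕ → Bool) → (ℕ → Bool) → ℕ → Bool
glue q c d x = if does (q ∣? x) then d (x / q) else c x

glue-multiple : ∀ q .{{_ : NonZero q}} c d y → glue q c d (q * y) ≡ d y
glue-multiple q c d y rewrite dec-true (q ∣? q * y) (m∣m*n y) =
  cong d (trans (cong (_/ q) (*-comm q y)) (m*n/n≡m y q))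

glue-nonmultiple : ∀ q .{{_ : NonZero q}} c d {x} → ¬ q ∣ x → glue q c d x ≡ c x
glue-nonmultiple q c d {x} q∤x rewrite dec-false (q ∣? x) q∤x = refl

balanced-glue : ∀ q n N .{{_ : NonZero q}} {c d} → ¬ q ∣ n
  → divisors (q * N) ↭ divisors n ++ map (q *_) (divisors N)
  → Balanced c (divisors n) → Balanced d (divisors N) → Balanced (glue q c d) (divisors (q * N))
balanced-glue q n N {c} {d} q∤n split bal-n bal-N =
  balanced-↭ (↭-sym split) (balanced-++ on-n on-qN)
  where
  on-n : Balanced (glue q c d) (divisors n)
  on-n = balanced-cong (λ x∈ → sym (glue-nonmultiple q c d (λ q∣x → q∤n (∣-trans q∣x (∈-divisors⁻ x∈))))) bal-n

  on-qN : Balanced (glue q c d) (map (q *_) (divisors N))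
  on-qN = balanced-map q (balanced-cong (λ {y} _ → sym (glue-multiple q c d y)) bal-N)

Zumkeller-glue : ∀ q {n N} .{{_ : NonZero q}}
  → n ∣ N → ¬ q ∣ n → (∀ {x} → x ∣ q * N → ¬ q ∣ x → x ∣ n)
  → Zumkeller n → Zumkeller N → Zumkeller (q * N)
Zumkeller-glue q {n} {N} n∣N q∤n coprime-part zn zN
  with Zumkeller⇒balanced {n} zn | Zumkeller⇒balanced {N} zN
... | c , bal-n | d , bal-N =
  balanced⇒Zumkeller {q * N} (balanced-glue q n N q∤n (divisors-split q n N n∣N q∤n coprime-part) bal-n bal-N)
  where
  instance
    n≢0 : NonZero n
    n≢0 = Zumkeller⇒nonZero {n} zn
    N≢0 : NonZero N
    N≢0 = Zumkeller⇒nonZero {N} zN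
    qN≢0 : NonZero (q * N)
    qN≢0 = m*n≢0 q N

prime∤1 : ∀ {p} → Prime p → ¬ p ∣ 1
prime∤1 pr p∣1 with ∣1⇒≡1 p∣1 | prime⇒nonTrivial pr
... | refl | ()

prime∤* : ∀ {p a b} → Prime p → ¬ p ∣ a → ¬ p ∣ b → ¬ p ∣ a * b
prime∤* {a = a} {b} pr p∤a p∤b p∣ab = [ p∤a , p∤b ] (euclidsLemma a b pr p∣ab)

prime∤⇒coprime : ∀ {p x} → Prime p → ¬ p ∣ x → Coprime x p
prime∤⇒coprime pr p∤x (d∣x , d∣p) with prime⇒irreducible pr d∣p
... | inj₁ d≡1 = d≡1
... | inj₂ refl = ⊥-elim (p∤x d∣x)

cancel-prime-power : ∀ {p x M} → Prime p → ¬ p ∣ x → ∀ s → x ∣ p ^ s * M → x ∣ M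
cancel-prime-power {x = x} {M} pr p∤x zero x∣ = subst (x ∣_) (*-identityˡ M) x∣
cancel-prime-power {p} {x} {M} pr p∤x (suc s) x∣ =
  cancel-prime-power pr p∤x s (coprime-divisor (prime∤⇒coprime pr p∤x) (subst (x ∣_) (*-assoc p (p ^ s) M) x∣))

-- If p^k ∣ M, a divisor x of p^s * M with p^(k+1) ∤ x already divides M:
-- the extra powers of p cannot be used by x.
strip-prime-power : ∀ {p} → Prime p → ∀ k s {x M}
  → p ^ k ∣ M → ¬ p ^ suc k ∣ x → x ∣ p ^ s * M → x ∣ M
strip-prime-power {p} pr k s {x} pᵏ∣M pᵏ⁺¹∤x x∣ with p ∣? x
... | no p∤x = cancel-prime-power pr p∤x s x∣
strip-prime-power {p} pr zero s pᵏ∣M pᵏ⁺¹∤x x∣ | yes p∣x =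
  ⊥-elim (pᵏ⁺¹∤x (subst (_∣ _) (sym (*-identityʳ p)) p∣x))
strip-prime-power {p} pr (suc k) s (divides m refl) pᵏ⁺¹∤x x∣ | yes (divides x' refl) =
  subst (x' * p ∣_) M'p≡M (*-monoˡ-∣ p x'∣M')
  where
  instance
    p≢0 : NonZero p
    p≢0 = prime⇒nonZero pr
  -- M = m * p^(k+1) = M' * p with p^k ∣ M'
  M' : ℕ
  M' = m * p ^ k
  M'p≡M : M' * p ≡ m * (p * p ^ k)
  M'p≡M = trans (*-assoc m (p ^ k) p) (cong (m *_) (*-comm (p ^ k) p))
  x'∣M' : x' ∣ M'
  x'∣M' = strip-prime-power pr k s (n∣m*n m)
    (λ pᵏ⁺¹∣x' → pᵏ⁺¹∤x (subst (_∣ x' * p) (*-comm (p ^ suc k) p) (*-monoˡ-∣ p pᵏ⁺¹∣x')))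
    (*-cancelʳ-∣ p (subst (x' * p ∣_)
      (trans (cong (p ^ s *_) (sym M'p≡M)) (sym (*-assoc (p ^ s) M' p))) x∣))

prime∤prime^ : ∀ {p q} → Prime p → Prime q → ¬ p ≡ q → ∀ e → ¬ p ∣ q ^ e
prime∤prime^ prp prq p≢q zero = prime∤1 prp
prime∤prime^ prp prq p≢q (suc e) = prime∤* prp p∤q (prime∤prime^ prp prq p≢q e)
  where
  p∤q : ¬ _ ∣ _
  p∤q p∣q with prime⇒irreducible prq p∣q
  ... | inj₁ refl = prime∤1 prp ∣-refl
  ... | inj₂ p≡q = p≢q p≡q

prime∤∏ : ∀ {p} → Prime p → ∀ m (f : Fin m → ℕ) → (∀ i → ¬ p ∣ f i) → ¬ p ∣ ∏ m f
prime∤∏ pr zero f p∤f = prime∤1 pr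
prime∤∏ pr (suc m) f p∤f =
  prime∤* pr (p∤f Fin.zero) (prime∤∏ pr m (λ i → f (Fin.suc i)) (λ i → p∤f (Fin.suc i)))

-- With q = p^(k+1) and p^k exactly dividing n, every q^j * n is Zumkeller:
-- a divisor of q^(j+1) * n not divisible by q divides n, so gluing applies.
Zumkeller-times-q^j : ∀ {p k n} → Prime p → p ^ k ∣ n → ¬ p ^ suc k ∣ n → Zumkeller n
  → ∀ j → Zumkeller ((p ^ suc k) ^ j * n)
Zumkeller-times-q^j {p} {k} {n} pr pᵏ∣n q∤n zn = times-q^j
  where
  q : ℕ
  q = p ^ suc k
  instance
    p≢0 : NonZero p
    p≢0 = prime⇒nonZero pr
    q≢0 : NonZero q
    q≢0 = m^n≢0 p (suc k)

  coprime-part : ∀ j {x} → x ∣ q ^ j * n → ¬ q ∣ x → x ∣ n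
  coprime-part j {x} x∣ q∤x =
    strip-prime-power pr k (suc k * j) pᵏ∣n q∤x (subst (λ a → x ∣ a * n) (^-*-assoc p (suc k) j) x∣)

  times-q^j : ∀ j → Zumkeller (q ^ j * n)
  times-q^j zero = subst Zumkeller (sym (*-identityˡ n)) zn
  times-q^j (suc j) = subst Zumkeller (sym (*-assoc q (q ^ j) n))
    (Zumkeller-glue q (∣n⇒∣m*n (q ^ j) ∣-refl) q∤n
      (λ {x} x∣ → coprime-part (suc j) (subst (x ∣_) (sym (*-assoc q (q ^ j) n)) x∣))
      zn (times-q^j j))

raise-exponent : ∀ {p R} → Prime p → ¬ p ∣ R → ∀ k l
  → Zumkeller (p ^ k * R) → Zumkeller (p ^ (k + l * (k + 1)) * R)
raise-exponent {p} {R} pr p∤R k l z =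
  subst Zumkeller exponents (Zumkeller-times-q^j {k = k} pr (m∣m*n R) pᵏ⁺¹∤pᵏR z l)
  where
  instance
    p≢0 : NonZero p
    p≢0 = prime⇒nonZero pr
    pᵏ≢0 : NonZero (p ^ k)
    pᵏ≢0 = m^n≢0 p k

  pᵏ⁺¹∤pᵏR : ¬ p ^ suc k ∣ p ^ k * R
  pᵏ⁺¹∤pᵏR d = p∤R (*-cancelˡ-∣ (p ^ k) (subst (_∣ p ^ k * R) (*-comm p (p ^ k)) d))

  exponent : suc k * l + k ≡ k + l * (k + 1)
  exponent = solve 2 (λ k l → (con 1 :+ k) :* l :+ k := k :+ l :* (k :+ con 1)) refl k l
    where open +-*-Solver

  exponents : (p ^ suc k) ^ l * (p ^ k * R) ≡ p ^ (k + l * (k + 1)) * R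
  exponents = begin
    (p ^ suc k) ^ l * (p ^ k * R)   ≡⟨ cong (_* (p ^ k * R)) (^-*-assoc p (suc k) l) ⟩
    p ^ (suc k * l) * (p ^ k * R)   ≡⟨ *-assoc (p ^ (suc k * l)) (p ^ k) R ⟨
    p ^ (suc k * l) * p ^ k * R     ≡⟨ cong (_* R) (^-distribˡ-+-* p (suc k * l) k) ⟨
    p ^ (suc k * l + k) * R         ≡⟨ cong (λ e → p ^ e * R) exponent ⟩
    p ^ (k + l * (k + 1)) * R       ∎
    where open ≡-Reasoning

-- Raise the exponents one prime at a time; the cofactor R collects the
-- already raised prime powers and stays coprime to the remaining primes.
raise-all : ∀ m (p k l : Fin m → ℕ) → (∀ i → Prime (p i)) → Injective _≡_ _≡_ p
  → ∀ R → (∀ i → ¬ p i ∣ R)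
  → Zumkeller (R * ∏ m (λ i → p i ^ k i))
  → Zumkeller (R * ∏ m (λ i → p i ^ (k i + l i * (k i + 1))))
raise-all zero p k l pr inj R p∤R z = z
raise-all (suc m) p k l pr inj R p∤R z =
  subst Zumkeller (*-assoc R (p₀ ^ e₀) _)
    (raise-all m (λ i → p (Fin.suc i)) (λ i → k (Fin.suc i)) (λ i → l (Fin.suc i))
      (λ i → pr (Fin.suc i)) (λ eq → Fin.suc-injective (inj eq)) (R * p₀ ^ e₀) p∤R' raised-p₀)
  where
  p₀ k₀ l₀ e₀ rest : ℕ
  p₀ = p Fin.zero
  k₀ = k Fin.zero
  l₀ = l Fin.zero
  e₀ = k₀ + l₀ * (k₀ + 1)
  rest = ∏ m (λ i → p (Fin.suc i) ^ k (Fin.suc i))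

  p₀∤rest : ¬ p₀ ∣ rest
  p₀∤rest = prime∤∏ (pr Fin.zero) m _ (λ i →
    prime∤prime^ (pr Fin.zero) (pr (Fin.suc i)) (λ eq → Fin.0≢1+n (inj eq)) (k (Fin.suc i)))

  raised-p₀ : Zumkeller (R * p₀ ^ e₀ * rest)
  raised-p₀ = subst Zumkeller (sym (xy∙z≈y∙xz R (p₀ ^ e₀) rest))
    (raise-exponent (pr Fin.zero) (prime∤* (pr Fin.zero) (p∤R Fin.zero) p₀∤rest) k₀ l₀
      (subst Zumkeller (x∙yz≈y∙xz R (p₀ ^ k₀) rest) z))

  p∤R' : ∀ i → ¬ p (Fin.suc i) ∣ R * p₀ ^ e₀
  p∤R' i = prime∤* (pr (Fin.suc i)) (p∤R (Fin.suc i))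
    (prime∤prime^ (pr (Fin.suc i)) (pr Fin.zero) (λ eq → Fin.0≢1+n (sym (inj eq))) e₀)

-- Main theorem.
mainTheorem4 : (n m : ℕ) (p : Fin m → ℕ) (k : Fin m → ℕ)
    → (∀ i → Prime (p i))
    → Injective _≡_ _≡_ p
    → (∀ i → k i ≥ 1)
    → n ≡ ∏ m (λ i → p i ^ k i)
    → Zumkeller n
    → (l : Fin m → ℕ)
    → (∀ i → l i ≥ 1)
    → Zumkeller (∏ m (λ i → p i ^ (k i + l i * (k i + 1))))
mainTheorem4 n m p k pr inj _ n≡∏ zn l _ =
  subst Zumkeller (*-identityˡ (∏ m (λ i → p i ^ (k i + l i * (k i + 1)))))
    (raise-all m p k l pr inj 1 (λ i → prime∤1 (pr i))
      (subst Zumkeller (trans n≡∏ (sym (*-identityˡ (∏ m (λ i → p i ^ k i))))) zn))
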